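{- Let $p\equiv 1\pmod 6$ be a prime. Then $$\sum_{x\in\mathbb{F}_p}\chi\left(x^{3}+1\right)\equiv 4\pmod 6.$$
   Context: $\chi$ denotes the Legendre symbol modulo $p$: $\chi(u)=1$ if $u$ is a nonzero square in $\mathbb{F}_p$, $\chi(u)=-1$ if $u$ is a non-square, and $\chi(0)=0$. -}

module Defs where

open import Data.Nat using (ℕ; zero; suc; _+_; _*_; _^_; _%_; _≡ᵇ_; NonZero)
open import Data.Nat.Primality using (Prime)
open import Data.Integer using (ℤ; +_; -[1+_])
open import Data.Bool using (Bool; true; false; if_then_else_)
open import Data.List using (List; upTo; map)
open import Data.Bool.ListAction using (any)
import Data.Integer as ℤ
open import Data.List using (foldr)

-- Elements of 𝔽_p are represented by residues 0,…,p-1 (ℕ, reduced mod p).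

isSquareMod : (p : ℕ) → .{{NonZero p}} → ℕ → Bool
isSquareMod p u = any (λ y → ((y * y) % p) ≡ᵇ (u % p)) (upTo p)

legendre : (p : ℕ) → .{{NonZero p}} → ℕ → ℤ
legendre p u with (u % p) ≡ᵇ 0
... | true  = + 0
... | false = if isSquareMod p u then + 1 else -[1+ 0 ]

charSum : (p : ℕ) → .{{NonZero p}} → ℤ
charSum p = foldr ℤ._+_ (+ 0) (map (λ x → legendre p (x ^ 3 + 1)) (upTo p))

-- Let ω be a root of x² + x + 1 in 𝔽_p. Multiplication by ω permutes 𝔽_p^× in orbits
-- of size 3 and preserves x³ + 1, so the numbers of x ≠ 0 with χ(x³ + 1) = 1 and with
-- χ(x³ + 1) = -1 are both multiples of 3, while x = 0 contributes χ(1) = 1. The zeros of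
-- x³ + 1 are exactly -1, -ω, -ω². Hence the sum is (1 + 3a) - 3b with (1 + 3a) + 3b + 3 = p,
-- and p ≡ 1 (mod 6) forces it to be 4 modulo 6.
-- The root ω exists since p ≡ 1 (mod 3): x ↦ 1/(1 - x) permutes {2, …, p - 1} in orbits of
-- size 1 or 3, and p - 2 ≢ 0 (mod 3), so it has a fixed point ζ; then ζ² - ζ + 1 = 0 and ω = -ζ.
module Submission where

open import Defs
open import Data.Nat using (ℕ; _%_; NonZero)
open import Data.Nat.Primality using (Prime)
open import Data.Integer using (ℤ; +_; _-_)
open import Data.Integer.Divisibility using (_∣_)
open import Relation.Binary.PropositionalEquality using (_≡_)

module Counting where

  open import Data.Bool using (Bool; true; false; _∧_; _∨_; not)
  import Data.Bool.Properties as BoolP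
  open BoolP using (∧-assoc; ∧-identityʳ; ∧-zeroʳ; ∧-inverseʳ; ¬-not)
  open import Data.Nat using (ℕ; zero; suc; _+_; _*_; _∸_; _<ᵇ_; _≤ᵇ_; _<_; _≤_; z<s; s<s; s≤s)
  open import Data.Nat.Properties using (_≟_; _≤?_; +-identityʳ; anyUpTo?; ≤-refl; ≤-trans; m≤n+m)
  open import Data.Nat.Tactic.RingSolver using (solve-∀)
  open import Data.List using (List; []; _∷_; [_]; length)
  open import Data.List.Membership.DecPropositional _≟_ using (_∈_; _∈?_)
  open import Data.List.Relation.Unary.All as All using (All; []; _∷_)
  open import Data.List.Relation.Unary.Any using (here; there)
  open import Data.List.Relation.Unary.AllPairs using ([]; _∷_)
  open import Data.List.Relation.Unary.Unique.Propositional using (Unique)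
  open import Data.Product using (∃; _×_; _,_; proj₁)
  open import Data.Sum using (_⊎_; inj₁; inj₂)
  open import Function using (_∘_)
  open import Relation.Nullary using (¬_; Dec; does; yes; no)
  open import Relation.Nullary.Decidable using (dec-true; dec-false)
  open import Relation.Binary.PropositionalEquality
    using (_≡_; _≢_; refl; subst; sym; trans; cong; cong₂; module ≡-Reasoning)

  private
    variable
      N a x : ℕ
      xs : List ℕ
      P : ℕ → Bool

  toℕ : Bool → ℕ
  toℕ false = 0
  toℕ true  = 1

  count : (ℕ → Bool) → ℕ → ℕ
  count P zero    = 0
  count P (suc N) = toℕ (P 0) + count (P ∘ suc) N

  _∖∖_ : (ℕ → Bool) → List ℕ → ℕ → Bool
  (P ∖∖ xs) y = P y ∧ not (does (y ∈? xs))

  ∧-≡-true : ∀ {b c} → b ∧ c ≡ true → b ≡ true × c ≡ true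
  ∧-≡-true {true} {true} refl = refl , refl

  does⇒ : ∀ {a} {A : Set a} (a? : Dec A) → does a? ≡ true → A
  does⇒ (yes a) _ = a

  does-≡ : ∀ {a b} {A : Set a} {B : Set b} → (A → B) → (B → A) →
           (a? : Dec A) (b? : Dec B) → does a? ≡ does b?
  does-≡ A→B B→A a? (yes b) = dec-true a? (B→A b)
  does-≡ A→B B→A a? (no ¬b) = dec-false a? (¬b ∘ A→B)

  search : ∀ (P : ℕ → Bool) N → (∃ λ y → y < N × P y ≡ true) ⊎ (∀ {y} → y < N → P y ≡ false)
  search P N with anyUpTo? {P = λ y → P y ≡ true} (λ y → P y BoolP.≟ true) N
  ... | yes witness = inj₁ witness
  ... | no  none    = inj₂ λ {y} y<N → ¬-not λ Py → none (y , y<N , Py)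

  count-cong : ∀ P Q N → (∀ {y} → y < N → P y ≡ Q y) → count P N ≡ count Q N
  count-cong P Q zero    P≗Q = refl
  count-cong P Q (suc N) P≗Q = cong₂ _+_ (cong toℕ (P≗Q z<s)) (count-cong (P ∘ suc) (Q ∘ suc) N (P≗Q ∘ s<s))

  count-none : ∀ P N → (∀ {y} → y < N → P y ≡ false) → count P N ≡ 0
  count-none P zero    none = refl
  count-none P (suc N) none rewrite none z<s = count-none (P ∘ suc) N (none ∘ s<s)

  count-≤? : ∀ k N → count (λ x → does (k ≤? x)) N ≡ N ∸ k
  count-≤? zero    zero    = refl
  count-≤? zero    (suc N) = cong suc (count-≤? zero N)
  count-≤? (suc k) zero    = refl
  count-≤? (suc k) (suc N) = trans (count-cong _ (λ x → does (k ≤? x)) N λ {x} _ → <ᵇ-suc k x) (count-≤? k N)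
    where
    <ᵇ-suc : ∀ k x → (k <ᵇ suc x) ≡ (k ≤ᵇ x)
    <ᵇ-suc zero    x = refl
    <ᵇ-suc (suc k) x = refl

  count-remove : ∀ P → a < N → count P N ≡ toℕ (P a) + count (P ∖∖ [ a ]) N
  count-remove {zero}  {suc N} P z<s = cong (_+_ (toℕ (P 0))) (sym (cong₂ _+_
    (cong toℕ (∧-zeroʳ (P 0))) (count-cong _ (P ∘ suc) N λ _ → ∧-identityʳ _)))
  count-remove {suc a} {suc N} P (s<s a<N) = begin
    toℕ (P 0) + count (P ∘ suc) N
      ≡⟨ cong (_+_ (toℕ (P 0))) (count-remove (P ∘ suc) a<N) ⟩
    toℕ (P 0) + (toℕ (P (suc a)) + count ((P ∘ suc) ∖∖ [ a ]) N)
      ≡⟨ swap (toℕ (P 0)) (toℕ (P (suc a))) _ ⟩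
    toℕ (P (suc a)) + (toℕ (P 0) + count ((P ∘ suc) ∖∖ [ a ]) N)
      ≡⟨ cong (λ b → toℕ (P (suc a)) + (toℕ b + count ((P ∘ suc) ∖∖ [ a ]) N)) (∧-identityʳ (P 0)) ⟨
    toℕ (P (suc a)) + count (P ∖∖ [ suc a ]) (suc N) ∎
    where
    open ≡-Reasoning
    swap : ∀ m n o → m + (n + o) ≡ n + (m + o)
    swap = solve-∀

  count-removeAll : ∀ P → Unique xs → All (_< N) xs → All (λ x → P x ≡ true) xs →
                    count P N ≡ length xs + count (P ∖∖ xs) N
  count-removeAll {[]} {N} P _ _ _ = count-cong P (P ∖∖ []) N λ _ → sym (∧-identityʳ _)
  count-removeAll {x ∷ xs} {N} P (x∉xs ∷ unique) (x<N ∷ xs<N) (Px ∷ Pxs) = begin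
    count P N
      ≡⟨ count-remove P x<N ⟩
    toℕ (P x) + count (P ∖∖ [ x ]) N
      ≡⟨ cong₂ _+_ (cong toℕ Px) (count-removeAll (P ∖∖ [ x ]) unique xs<N P∖x-xs) ⟩
    suc (length xs + count ((P ∖∖ [ x ]) ∖∖ xs) N)
      ≡⟨ cong (suc ∘ (_+_ (length xs))) (count-cong _ _ N λ {y} _ → merge (P y) _ _) ⟩
    suc (length xs + count (P ∖∖ (x ∷ xs)) N) ∎
    where
    open ≡-Reasoning
    P∖x-xs : All (λ y → (P ∖∖ [ x ]) y ≡ true) xs
    P∖x-xs = All.zipWith (λ (x≢y , Py) → cong₂ (λ b c → b ∧ not (c ∨ false)) Py (dec-false (_ ≟ x) (x≢y ∘ sym)))
                         (x∉xs , Pxs)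
    merge : ∀ b c d → (b ∧ not (c ∨ false)) ∧ not d ≡ b ∧ not (c ∨ d)
    merge false _     _ = refl
    merge true  true  _ = refl
    merge true  false _ = refl

  count-removeDisjoint : ∀ P N → All (λ x → P x ≡ false) xs → count P N ≡ count (P ∖∖ xs) N
  count-removeDisjoint {xs} P N notP = count-cong P (P ∖∖ xs) N λ {y} _ → pointwise y
    where
    pointwise : ∀ y → P y ≡ (P ∖∖ xs) y
    pointwise y with y ∈? xs
    ... | yes y∈xs = trans (All.lookup notP y∈xs) (sym (∧-zeroʳ _))
    ... | no  _    = sym (∧-identityʳ _)

  count-∈ : Unique xs → All (_< N) xs → count (λ y → does (y ∈? xs)) N ≡ length xs
  count-∈ {xs} {N} unique xs<N = begin
    count (λ y → does (y ∈? xs)) N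
      ≡⟨ count-removeAll _ unique xs<N (All.tabulate (dec-true (_ ∈? xs))) ⟩
    length xs + count (_ ∖∖ xs) N
      ≡⟨ cong (_+_ (length xs)) (count-none _ N λ {y} _ → ∧-inverseʳ (does (y ∈? xs))) ⟩
    length xs + 0
      ≡⟨ +-identityʳ _ ⟩
    length xs ∎
    where open ≡-Reasoning

  count-partition : ∀ A B C N → (∀ y → toℕ (A y) + toℕ (B y) + toℕ (C y) ≡ 1) →
                    count A N + count B N + count C N ≡ N
  count-partition A B C zero    _         = refl
  count-partition A B C (suc N) partition =
    trans (ring (toℕ (A 0)) (toℕ (B 0)) (toℕ (C 0)) _ _ _)
          (cong₂ _+_ (partition 0) (count-partition (A ∘ suc) (B ∘ suc) (C ∘ suc) N (partition ∘ suc)))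
    where
    ring : ∀ a b c x y z → a + x + (b + y) + (c + z) ≡ a + b + c + (x + y + z)
    ring = solve-∀

  module FixedPoints (N : ℕ) (σ : ℕ → ℕ) where

    record Order3On (P : ℕ → Bool) : Set where
      field
        σ-< : ∀ {y} → y < N → P y ≡ true → σ y < N
        σ-P : ∀ {y} → y < N → P y ≡ true → P (σ y) ≡ true
        σ³  : ∀ {y} → y < N → P y ≡ true → σ (σ (σ y)) ≡ y
    open Order3On

    Fix : (ℕ → Bool) → ℕ → Bool
    Fix P y = does (σ y ≟ y) ∧ P y

    orbit : ℕ → List ℕ
    orbit x = x ∷ σ x ∷ σ (σ x) ∷ []

    orbit-closed : σ (σ (σ x)) ≡ x → ∀ {z} → z ∈ orbit x → σ z ∈ orbit x
    orbit-closed σ³x (here refl)                 = there (here refl)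
    orbit-closed σ³x (there (here refl))         = there (there (here refl))
    orbit-closed σ³x (there (there (here refl))) = here σ³x

    σ²x≢x : σ x ≢ x → σ (σ (σ x)) ≡ x → σ (σ x) ≢ x
    σ²x≢x moved σ³x σ²x≡x = moved (trans (sym (cong σ σ²x≡x)) σ³x)

    σ²x≢σx : σ x ≢ x → σ (σ (σ x)) ≡ x → σ (σ x) ≢ σ x
    σ²x≢σx moved σ³x σ²x≡σx = moved (trans (sym σ²x≡σx) (trans (sym (cong σ σ²x≡σx)) σ³x))

    orbit-unique : σ x ≢ x → σ (σ (σ x)) ≡ x → Unique (orbit x)
    orbit-unique moved σ³x =
      (moved ∘ sym ∷ σ²x≢x moved σ³x ∘ sym ∷ []) ∷ (σ²x≢σx moved σ³x ∘ sym ∷ []) ∷ [] ∷ []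

    ∖∖-Order3On : Order3On P → (∀ {z} → z ∈ xs → σ z ∈ xs) → Order3On (P ∖∖ xs)
    σ-< (∖∖-Order3On inv _) y<N Py∖xs = σ-< inv y<N (proj₁ (∧-≡-true Py∖xs))
    σ³  (∖∖-Order3On inv _) y<N Py∖xs = σ³ inv y<N (proj₁ (∧-≡-true Py∖xs))
    σ-P (∖∖-Order3On {P} {xs} inv closed) {y} y<N Py∖xs with y ∈? xs | ∧-≡-true {P y} Py∖xs
    ... | no y∉xs | Py , _ = cong₂ _∧_ (σ-P inv y<N Py) (cong not (dec-false (σ y ∈? xs) σy∉xs))
      where
      σy∉xs : ¬ σ y ∈ xs
      σy∉xs σy∈xs = y∉xs (subst (_∈ xs) (σ³ inv y<N Py) (closed (closed σy∈xs)))

    count-Fix-∖∖ : ∀ P xs → count (Fix P ∖∖ xs) N ≡ count (Fix (P ∖∖ xs)) N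
    count-Fix-∖∖ P xs = count-cong _ _ N λ {y} _ → ∧-assoc (does (σ y ≟ y)) (P y) _

    peel-fixed : Order3On P → x < N → P x ≡ true → σ x ≡ x →
                 count P N ≡ suc (count (P ∖∖ [ x ]) N) × count (Fix P) N ≡ suc (count (Fix (P ∖∖ [ x ])) N)
    peel-fixed {P} {x} inv x<N Px fixed =
      count-removeAll P ([] ∷ []) (x<N ∷ []) (Px ∷ []) ,
      trans (count-removeAll (Fix P) ([] ∷ []) (x<N ∷ []) (cong₂ _∧_ (dec-true (σ x ≟ x) fixed) Px ∷ []))
            (cong suc (count-Fix-∖∖ P [ x ]))

    peel-orbit : Order3On P → x < N → P x ≡ true → σ x ≢ x →
                 count P N ≡ 3 + count (P ∖∖ orbit x) N × count (Fix P) N ≡ count (Fix (P ∖∖ orbit x)) N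
    peel-orbit {P} {x} inv x<N Px moved =
      count-removeAll P (orbit-unique moved σ³x) (x<N ∷ σx<N ∷ σ-< inv σx<N Pσx ∷ [])
                        (Px ∷ Pσx ∷ σ-P inv σx<N Pσx ∷ []) ,
      trans (count-removeDisjoint (Fix P) N
               (unfixed moved ∷ unfixed (σ²x≢σx moved σ³x) ∷ unfixed σ³x≢σ²x ∷ []))
            (count-Fix-∖∖ P (orbit x))
      where
      σ³x = σ³ inv x<N Px
      σx<N = σ-< inv x<N Px
      Pσx = σ-P inv x<N Px
      unfixed : ∀ {z} → σ z ≢ z → Fix P z ≡ false
      unfixed {z} σz≢z = cong (_∧ P z) (dec-false (σ z ≟ z) σz≢z)
      σ³x≢σ²x : σ (σ (σ x)) ≢ σ (σ x)
      σ³x≢σ²x σ³x≡σ²x = σ²x≢x moved σ³x (trans (sym σ³x≡σ²x) σ³x)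

    -- Induction on count P N: each step removes one orbit, which has size 1 exactly when it is a fixed point.
    count≡countFix+3k : ∀ P → Order3On P → ∃ λ k → count P N ≡ count (Fix P) N + 3 * k
    count≡countFix+3k P = go (suc (count P N)) P ≤-refl
      where
      shrink : ∀ {n c c′} l → c ≡ suc (l + c′) → c < suc n → c′ < n
      shrink l refl (s≤s c≤n) = ≤-trans (s≤s (m≤n+m _ l)) c≤n

      go : ∀ n P → count P N < n → Order3On P → ∃ λ k → count P N ≡ count (Fix P) N + 3 * k
      go (suc n) P c<n inv with search P N
      ... | inj₂ none = 0 , trans (count-none P N none) (sym (trans (+-identityʳ _)
                               (count-none (Fix P) N λ y<N → trans (cong (_ ∧_) (none y<N)) (∧-zeroʳ _))))
      ... | inj₁ (x , x<N , Px) with σ x ≟ x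
      ... | yes fixed =
        let (eP , eF) = peel-fixed inv x<N Px fixed
            (k , IH)  = go n (P ∖∖ [ x ]) (shrink 0 eP c<n)
                           (∖∖-Order3On {xs = [ x ]} inv λ { (here refl) → here fixed })
        in k , trans eP (trans (cong suc IH) (cong (_+ 3 * k) (sym eF)))
      ... | no moved =
        let (eP , eF) = peel-orbit inv x<N Px moved
            (k , IH)  = go n (P ∖∖ orbit x) (shrink 2 eP c<n) (∖∖-Order3On inv (orbit-closed (σ³ inv x<N Px)))
        in suc k , trans eP (trans (cong (_+_ 3) IH) (trans (cong (λ c → 3 + (c + 3 * k)) (sym eF)) (shift _ k)))
        where
        shift : ∀ c k → 3 + (c + 3 * k) ≡ c + 3 * suc k
        shift = solve-∀

open Counting

open import Data.Bool using (Bool; true; false; _∧_; not)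
open import Data.Bool.ListAction using (any)
open import Data.Bool.Properties using (T-≡; ∧-zeroʳ)
open import Data.Integer as ℤ using (_+_; _*_; -_)
open import Data.Integer.Properties using (pos-+; pos-*; m-n≡m⊖n; ⊖-≥; abs-*; *-comm; *-assoc)
import Data.Integer.Divisibility.Signed as Signed
open Signed using (∣⇒∣ᵤ; ∣ᵤ⇒∣; ∣-refl; ∣m∣n⇒∣m+n; ∣n⇒∣m*n; _∣?_)
open import Data.Integer.Tactic.RingSolver using (solve-∀)
open import Data.List using (List; [_]; _∷_; []; upTo; applyUpTo; map; foldr)
open import Data.List.Membership.Propositional using (lose)
open import Data.List.Membership.Propositional.Properties using (∈-upTo⁺)
open import Data.List.Properties using (map-cong)
open import Data.List.Relation.Unary.All using (_∷_; [])
open import Data.List.Relation.Unary.Any using (here; there)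
open import Data.List.Relation.Unary.Any.Properties using (any⁺)
open import Data.Nat as ℕ using (zero; suc; _≡ᵇ_; _<_; _≤_; _∸_; _/_; _^_; >-nonZero; s≤s; z≤n)
open import Data.Nat.Properties as ℕ
  using ( _≟_; _≤?_; *-zeroʳ; ≤-total; ≤-antisym; ≤-<-trans; <-trans; n<1+n
        ; m∸n≡0⇒m≤n; m∸n≤m; ∸-monoʳ-<; m<n⇒0<n∸m; m∸n+n≡m; anyUpTo?)
open import Data.List.Membership.DecPropositional _≟_ using (_∈_; _∈?_)
open import Data.Nat.DivMod using (m≡m%n+[m/n]*n; m%n<n; [m+kn]%n≡m%n; m%n%n≡m%n; m<n⇒m%n≡m; m∣n⇒o%n%m≡o%m)
import Data.Nat.Divisibility as ℕ∣
open ℕ∣ using (>⇒∤; m%n≡0⇒n∣m; n∣m⇒m%n≡0)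
open import Data.Nat.Primality using (euclidsLemma; prime⇒nonTrivial)
open import Data.Nat.Coprimality as Coprime using (coprime-Bézout; prime⇒coprime)
open import Data.Nat.GCD using (module Bézout)
open import Data.Product using (∃; _×_; _,_; proj₁; proj₂)
open import Data.Sum using (_⊎_; inj₁; inj₂)
open import Function using (_∘_; id)
open import Function.Bundles using (Equivalence)
open import Relation.Nullary using (¬_; does; yes; no; contradiction)
open import Relation.Nullary.Decidable using (dec-true; dec-false)
open import Relation.Binary.PropositionalEquality
  using (_≢_; refl; sym; trans; cong; cong₂; subst; subst₂; module ≡-Reasoning)

private
  variable
    a b c e : ℤ

sum-applyUpTo : ∀ (A B : ℕ → Bool) f N →
  foldr _+_ (+ 0) (map (λ x → + toℕ (A x) - + toℕ (B x)) (applyUpTo f N))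
    ≡ + count (A ∘ f) N - + count (B ∘ f) N
sum-applyUpTo A B f zero    = refl
sum-applyUpTo A B f (suc N) = trans (cong (_+_ (+ toℕ (A (f 0)) - + toℕ (B (f 0)))) (sum-applyUpTo A B (f ∘ suc) N))
  (ring (+ toℕ (A (f 0))) (+ toℕ (B (f 0))) (+ count (A ∘ f ∘ suc) N) (+ count (B ∘ f ∘ suc) N))
  where
  ring : ∀ a b c d → a - b + (c - d) ≡ a + c - (b + d)
  ring = solve-∀

n%3≡1⇒3<n : ∀ {n} → 1 < n → n % 3 ≡ 1 → 3 < n
n%3≡1⇒3<n {1} (s≤s ()) _
n%3≡1⇒3<n {2} _ ()
n%3≡1⇒3<n {3} _ ()
n%3≡1⇒3<n {suc (suc (suc (suc _)))} _ _ = s≤s (s≤s (s≤s (s≤s z≤n)))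

module _ (p : ℕ) .{{_ : NonZero p}} where

  private
    variable
      x y z u v : ℕ

  infix 4 p∣_
  p∣_ : ℤ → Set
  p∣ e = + p Signed.∣ e

  ∣-lin₁ : p∣ a → ∀ c₁ → e ≡ c₁ * a → p∣ e
  ∣-lin₁ p∣a c₁ refl = ∣n⇒∣m*n c₁ p∣a

  ∣-lin₂ : p∣ a → p∣ b → ∀ c₁ c₂ → e ≡ c₁ * a + c₂ * b → p∣ e
  ∣-lin₂ p∣a p∣b c₁ c₂ refl = ∣m∣n⇒∣m+n (∣n⇒∣m*n c₁ p∣a) (∣n⇒∣m*n c₂ p∣b)

  ∣-lin₃ : p∣ a → p∣ b → p∣ c → ∀ c₁ c₂ c₃ → e ≡ c₁ * a + c₂ * b + c₃ * c → p∣ e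
  ∣-lin₃ p∣a p∣b p∣c c₁ c₂ c₃ refl = ∣m∣n⇒∣m+n (∣-lin₂ p∣a p∣b c₁ c₂ refl) (∣n⇒∣m*n c₃ p∣c)

  +-divMod : ∀ u → + u ≡ + (u % p) + + (u / p) * + p
  +-divMod u = trans (cong +_ (m≡m%n+[m/n]*n u p))
                     (trans (pos-+ (u % p) (u / p ℕ.* p)) (cong (_+_ (+ (u % p))) (pos-* (u / p) p)))

  private
    ≤-residue-injective : y ≤ x → x < p → p∣ + x - + y → x ≡ y
    ≤-residue-injective {y} {x} y≤x x<p p∣x-y
      with x ∸ y in x∸y≡ | ∣⇒∣ᵤ (subst p∣_ (trans (m-n≡m⊖n x y) (⊖-≥ y≤x)) p∣x-y)
    ... | zero  | _   = ≤-antisym (m∸n≡0⇒m≤n x∸y≡) y≤x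
    ... | suc _ | p∣d = contradiction p∣d (>⇒∤ (≤-<-trans (subst (_≤ x) x∸y≡ (m∸n≤m x y)) x<p))

  residue-injective : x < p → y < p → p∣ + x - + y → x ≡ y
  residue-injective {x} {y} x<p y<p p∣x-y with ≤-total y x
  ... | inj₁ y≤x = ≤-residue-injective y≤x x<p p∣x-y
  ... | inj₂ x≤y = sym (≤-residue-injective x≤y y<p
                          (∣-lin₁ p∣x-y (- + 1) (ring (+ x) (+ y))))
    where
    ring : ∀ X Y → Y - X ≡ - + 1 * (X - Y)
    ring = solve-∀

  ∣-⇒%≡ : ∀ u v → p∣ + u - + v → u % p ≡ v % p
  ∣-⇒%≡ u v p∣u-v = residue-injective (m%n<n u p) (m%n<n v p)
    (∣-lin₂ p∣u-v ∣-refl (+ 1) (+ (v / p) - + (u / p)) (trans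
      (ring (+ (u % p)) (+ (v % p)) (+ (u / p)) (+ (v / p)) (+ p))
      (cong₂ (λ u′ v′ → + 1 * (u′ - v′) + (+ (v / p) - + (u / p)) * + p)
             (sym (+-divMod u)) (sym (+-divMod v)))))
    where
    ring : ∀ U V A B P → U - V ≡ + 1 * ((U + A * P) - (V + B * P)) + (B - A) * P
    ring = solve-∀

  %≡⇒∣- : ∀ u v → u % p ≡ v % p → p∣ + u - + v
  %≡⇒∣- u v u%p≡v%p = ∣-lin₁ ∣-refl (+ (u / p) - + (v / p)) (trans
    (cong₂ _-_ (+-divMod u) (+-divMod v))
    (trans (cong (λ r → + r + + (u / p) * + p - (+ (v % p) + + (v / p) * + p)) u%p≡v%p)
           (ring (+ (v % p)) (+ (u / p)) (+ (v / p)) (+ p))))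
    where
    ring : ∀ V A B P → V + A * P - (V + B * P) ≡ (A - B) * P
    ring = solve-∀

  ∤-positive : 0 < x → x < p → ¬ p∣ + x
  ∤-positive 0<x x<p p∣x = >⇒∤ {{>-nonZero 0<x}} x<p (∣⇒∣ᵤ p∣x)

  module _ (p-prime : Prime p) where

    1<p : 1 < p
    1<p = ℕ.nonTrivial⇒n>1 p {{prime⇒nonTrivial p-prime}}

    0<p : 0 < p
    0<p = <-trans (s≤s z≤n) 1<p

    ∣*⇒∣⊎∣ : p∣ a * b → p∣ a ⊎ p∣ b
    ∣*⇒∣⊎∣ {a} {b} p∣ab
      with euclidsLemma ℤ.∣ a ∣ ℤ.∣ b ∣ p-prime (subst (p ℕ∣.∣_) (abs-* a b) (∣⇒∣ᵤ p∣ab))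
    ... | inj₁ p∣a = inj₁ (∣ᵤ⇒∣ p∣a)
    ... | inj₂ p∣b = inj₂ (∣ᵤ⇒∣ p∣b)

    private
      ∃-inverse : 0 < u → u < p → ∃ λ t → p∣ + u * + t - + 1
      ∃-inverse {u} 0<u u<p with coprime-Bézout (Coprime.sym (prime⇒coprime p-prime {{>-nonZero 0<u}} u<p))
      ... | Bézout.+- t s 1+sp≡tu = t , ∣-lin₁ ∣-refl (+ s) (begin
        + u * + t - + 1           ≡⟨ cong (_- + 1) (*-comm (+ u) (+ t)) ⟩
        + t * + u - + 1           ≡⟨ cong (_- + 1) (trans (sym (pos-* t u)) (cong +_ (sym 1+sp≡tu))) ⟩
        + (1 ℕ.+ s ℕ.* p) - + 1   ≡⟨ cong (λ sp → + 1 + sp - + 1) (pos-* s p) ⟩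
        + 1 + + s * + p - + 1     ≡⟨ ring (+ s * + p) ⟩
        + s * + p                 ∎)
        where
        open ≡-Reasoning
        ring : ∀ X → + 1 + X - + 1 ≡ X
        ring = solve-∀
      -- Here t u ≡ -1, so u · (t t u) = (t u)² ≡ 1.
      ... | Bézout.-+ t s 1+tu≡sp = t ℕ.* t ℕ.* u , ∣-lin₁ ∣-refl ((+ t * + u - + 1) * + s) (begin
        + u * + (t ℕ.* t ℕ.* u) - + 1
          ≡⟨ cong (λ z → + u * z - + 1) (trans (pos-* (t ℕ.* t) u) (cong (_* + u) (pos-* t t))) ⟩
        + u * (+ t * + t * + u) - + 1            ≡⟨ ring₁ (+ u) (+ t) ⟩
        (+ t * + u - + 1) * (+ 1 + + t * + u)    ≡⟨ cong ((+ t * + u - + 1) *_) 1+tu≡spℤ ⟩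
        (+ t * + u - + 1) * (+ s * + p)          ≡⟨ *-assoc (+ t * + u - + 1) (+ s) (+ p) ⟨
        (+ t * + u - + 1) * + s * + p            ∎)
        where
        open ≡-Reasoning
        ring₁ : ∀ U T → U * (T * T * U) - + 1 ≡ (T * U - + 1) * (+ 1 + T * U)
        ring₁ = solve-∀
        1+tu≡spℤ : + 1 + + t * + u ≡ + s * + p
        1+tu≡spℤ = trans (cong (_+_ (+ 1)) (sym (pos-* t u))) (trans (cong +_ 1+tu≡sp) (pos-* s p))

    -- Opaque: only inverse-spec is used downstream.
    opaque
      inverse : ℕ → ℕ
      inverse u with anyUpTo? {P = λ t → p∣ + u * + t - + 1} (λ t → + p ∣? + u * + t - + 1) p
      ... | yes (t , _) = t
      ... | no  _       = 0

      inverse-spec : 0 < u → u < p → inverse u < p × p∣ + u * + inverse u - + 1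
      inverse-spec {u} 0<u u<p with anyUpTo? {P = λ t → p∣ + u * + t - + 1} (λ t → + p ∣? + u * + t - + 1) p
      ... | yes (_ , t<p , p∣ut-1) = t<p , p∣ut-1
      ... | no  none with ∃-inverse 0<u u<p
      ...   | t , p∣ut-1 = contradiction (t % p , m%n<n t p , p∣u[t%p]-1) none
        where
        p∣u[t%p]-1 : p∣ + u * + (t % p) - + 1
        p∣u[t%p]-1 = ∣-lin₂ p∣ut-1 ∣-refl (+ 1) (- (+ u * + (t / p))) (trans
          (ring (+ u) (+ (t % p)) (+ (t / p)) (+ p))
          (cong (λ t′ → + 1 * (+ u * t′ - + 1) + - (+ u * + (t / p)) * + p) (sym (+-divMod t))))
          where
          ring : ∀ U R Q P → U * R - + 1 ≡ + 1 * (U * (R + Q * P) - + 1) + - (U * Q) * P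
          ring = solve-∀

    infix 4 _≈1/[1-_]
    _≈1/[1-_] : ℕ → ℕ → Set
    y ≈1/[1- x ] = p∣ + y * (+ 1 - + x) - + 1

    -- suc p ∸ x stands for 1 - x, and lies in 1 … p - 2 when 2 ≤ x < p.
    μ : ℕ → ℕ
    μ x = inverse (suc p ∸ x)

    μ-spec : 2 ≤ x → x < p → μ x < p × μ x ≈1/[1- x ]
    μ-spec {x} 2≤x x<p = μx<p , ∣-lin₂ p∣uμx-1 ∣-refl (+ 1) (- + μ x) (trans
        (ring (+ x) (+ μ x) (+ p))
        (cong (λ u′ → + 1 * (u′ * + μ x - + 1) + - + μ x * + p) (sym +u≡1+p-x)))
      where
      x≤1+p = ℕ.<⇒≤ (<-trans x<p (n<1+n p))
      spec = inverse-spec (m<n⇒0<n∸m (<-trans x<p (n<1+n p))) (∸-monoʳ-< {o = 1} 2≤x x≤1+p)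
      μx<p = proj₁ spec
      p∣uμx-1 = proj₂ spec
      +u≡1+p-x : + (suc p ∸ x) ≡ + 1 + + p - + x
      +u≡1+p-x = sym (trans (m-n≡m⊖n (suc p) x) (⊖-≥ x≤1+p))
      ring : ∀ X Y P → Y * (+ 1 - X) - + 1 ≡ + 1 * ((+ 1 + P - X) * Y - + 1) + - Y * P
      ring = solve-∀

    ≈1/[1-]-≥2 : 2 ≤ x → x < p → y ≈1/[1- x ] → 2 ≤ y
    ≈1/[1-]-≥2 {y = 0} _ _ p∣-1 = contradiction (∣-lin₁ p∣-1 (- + 1) refl) (∤-positive (s≤s z≤n) 1<p)
    ≈1/[1-]-≥2 {x} {y = 1} 2≤x x<p p∣-x =
      contradiction (∣-lin₁ p∣-x (- + 1) (ring (+ x))) (∤-positive (<-trans (s≤s z≤n) 2≤x) x<p)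
      where
      ring : ∀ X → X ≡ - + 1 * (+ 1 * (+ 1 - X) - + 1)
      ring = solve-∀
    ≈1/[1-]-≥2 {y = suc (suc _)} _ _ _ = s≤s (s≤s z≤n)

    ≈1/[1-]-rotate : y ≈1/[1- x ] → z ≈1/[1- y ] → x ≈1/[1- z ]
    ≈1/[1-]-rotate {y} {x} {z} y≈ z≈ = ∣-lin₂ y≈ z≈ (+ z) (+ 1 - + x) (ring (+ x) (+ y) (+ z))
      where
      ring : ∀ X Y Z → X * (+ 1 - Z) - + 1 ≡ Z * (Y * (+ 1 - X) - + 1) + (+ 1 - X) * (Z * (+ 1 - Y) - + 1)
      ring = solve-∀

    ≈1/[1-]-functional : 2 ≤ x → x < p → y < p → z < p → y ≈1/[1- x ] → z ≈1/[1- x ] → y ≡ z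
    ≈1/[1-]-functional {x} {y} {z} 2≤x x<p y<p z<p y≈ z≈
      with ∣*⇒∣⊎∣ (∣-lin₂ y≈ z≈ (+ 1) (- + 1) (ring (+ x) (+ y) (+ z)))
      where
      ring : ∀ X Y Z → (Y - Z) * (+ 1 - X) ≡ + 1 * (Y * (+ 1 - X) - + 1) + - + 1 * (Z * (+ 1 - X) - + 1)
      ring = solve-∀
    ... | inj₁ p∣y-z = residue-injective y<p z<p p∣y-z
    ... | inj₂ p∣1-x = contradiction 2≤x (ℕ.<-irrefl (residue-injective 1<p x<p p∣1-x))

    μ³ : 2 ≤ x → x < p → μ (μ (μ x)) ≡ x
    μ³ {x} 2≤x x<p = ≈1/[1-]-functional 2≤μ²x μ²x<p (proj₁ (μ-spec 2≤μ²x μ²x<p)) x<p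
                       (proj₂ (μ-spec 2≤μ²x μ²x<p)) (≈1/[1-]-rotate {μ x} {x} {μ (μ x)} μx≈ μ²x≈)
      where
      μx<p = proj₁ (μ-spec 2≤x x<p)
      μx≈ = proj₂ (μ-spec 2≤x x<p)
      2≤μx = ≈1/[1-]-≥2 {y = μ x} 2≤x x<p μx≈
      μ²x<p = proj₁ (μ-spec 2≤μx μx<p)
      μ²x≈ = proj₂ (μ-spec 2≤μx μx<p)
      2≤μ²x = ≈1/[1-]-≥2 {y = μ (μ x)} 2≤μx μx<p μ²x≈

    private
      module OrbitsOfμ = FixedPoints p μ

    μ-Order3On : OrbitsOfμ.Order3On (λ x → does (2 ≤? x))
    μ-Order3On = record
      { σ-< = λ {x} x<p 2≤x → proj₁ (μ-spec (does⇒ (2 ≤? x) 2≤x) x<p)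
      ; σ-P = λ {x} x<p 2≤x → let 2≤x = does⇒ (2 ≤? x) 2≤x in
                dec-true (2 ≤? μ x) (≈1/[1-]-≥2 {y = μ x} 2≤x x<p (proj₂ (μ-spec 2≤x x<p)))
      ; σ³  = λ {x} x<p 2≤x → μ³ (does⇒ (2 ≤? x) 2≤x) x<p
      }

    private
      p∸2≢3k : p % 3 ≡ 1 → ∀ k → p ∸ 2 ≢ 3 ℕ.* k
      p∸2≢3k p%3≡1 k p∸2≡3k =
        contradiction (trans (sym p%3≡1) (trans (cong (_% 3) p≡2+3k) ([m+kn]%n≡m%n 2 k 3))) λ ()
        where
        p≡2+3k : p ≡ 2 ℕ.+ k ℕ.* 3
        p≡2+3k = begin
          p                ≡⟨ m∸n+n≡m 1<p ⟨
          p ∸ 2 ℕ.+ 2      ≡⟨ cong (ℕ._+ 2) p∸2≡3k ⟩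
          3 ℕ.* k ℕ.+ 2    ≡⟨ ℕ.+-comm (3 ℕ.* k) 2 ⟩
          2 ℕ.+ 3 ℕ.* k    ≡⟨ cong (2 ℕ.+_) (ℕ.*-comm 3 k) ⟩
          2 ℕ.+ k ℕ.* 3    ∎
          where open ≡-Reasoning

    ∃-fixed-point : p % 3 ≡ 1 → ∃ λ ζ → 2 ≤ ζ × ζ < p × ζ ≈1/[1- ζ ]
    ∃-fixed-point p%3≡1 with search (OrbitsOfμ.Fix (λ x → does (2 ≤? x))) p
    ... | inj₁ (ζ , ζ<p , Fixζ) =
      ζ , 2≤ζ , ζ<p , subst (_≈1/[1- ζ ]) (does⇒ (μ ζ ≟ ζ) μζ≡ζ) (proj₂ (μ-spec 2≤ζ ζ<p))
      where
      μζ≡ζ = proj₁ (∧-≡-true Fixζ)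
      2≤ζ = does⇒ (2 ≤? ζ) (proj₂ (∧-≡-true Fixζ))
    ... | inj₂ none with OrbitsOfμ.count≡countFix+3k _ μ-Order3On
    ...   | k , count≡ = contradiction (begin
      p ∸ 2
        ≡⟨ count-≤? 2 p ⟨
      count (λ x → does (2 ≤? x)) p
        ≡⟨ count≡ ⟩
      count (OrbitsOfμ.Fix (λ x → does (2 ≤? x))) p ℕ.+ 3 ℕ.* k
        ≡⟨ cong (ℕ._+ 3 ℕ.* k) (count-none _ p none) ⟩
      3 ℕ.* k ∎) (p∸2≢3k p%3≡1 k)
      where open ≡-Reasoning

    ∃-root-of-x²+x+1 : p % 3 ≡ 1 → ∃ λ ω → ω < p × p∣ + ω * + ω + + ω + + 1
    ∃-root-of-x²+x+1 p%3≡1 with ∃-fixed-point p%3≡1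
    ... | ζ , 2≤ζ , ζ<p , ζ≈ = p ∸ ζ , ∸-monoʳ-< (<-trans (s≤s z≤n) 2≤ζ) (ℕ.<⇒≤ ζ<p) ,
      ∣-lin₂ ζ≈ ∣-refl (- + 1) (+ p - + 2 * + ζ + + 1) (trans
        (cong (λ w → w * w + w + + 1) (sym (trans (m-n≡m⊖n p ζ) (⊖-≥ (ℕ.<⇒≤ ζ<p)))))
        (ring (+ ζ) (+ p)))
      where
      ring : ∀ Z P → (P - Z) * (P - Z) + (P - Z) + + 1 ≡ - + 1 * (Z * (+ 1 - Z) - + 1) + (P - + 2 * Z + + 1) * P
      ring = solve-∀

    +-^3 : ∀ x → + (x ^ 3) ≡ + x * + x * + x
    +-^3 x = trans (pos-* x _) (trans (cong (+ x *_) (trans (pos-* x _) (cong (+ x *_) (pos-* x 1)))) (ring (+ x)))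
      where
      ring : ∀ X → X * (X * (X * + 1)) ≡ X * X * X
      ring = solve-∀

    module Rotation (p%3≡1 : p % 3 ≡ 1) {ω : ℕ} (p∣ω²+ω+1 : p∣ + ω * + ω + + ω + + 1) where

      opaque
        ρ : ℕ → ℕ
        ρ x = (ω ℕ.* x) % p

        ρ-< : ρ x < p
        ρ-< = m%n<n _ p

        ρ-spec : ∀ x → p∣ + ρ x - + ω * + x
        ρ-spec x = subst (λ t → p∣ + ρ x - t) (pos-* ω x)
                         (%≡⇒∣- (ρ x) (ω ℕ.* x) (m%n%n≡m%n (ω ℕ.* x) p))

        ρ-0 : ρ 0 ≡ 0
        ρ-0 = trans (cong (_% p) (*-zeroʳ ω)) (m<n⇒m%n≡m 0<p)

      private
        module OrbitsOfρ = FixedPoints p ρ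

      ρ-cong : p∣ + x + c → p∣ + ρ x + + ω * c
      ρ-cong {x} {c} p∣x+c = ∣-lin₂ (ρ-spec x) p∣x+c (+ 1) (+ ω) (ring (+ ρ x) (+ ω) (+ x) c)
        where
        ring : ∀ R W X C → R + W * C ≡ + 1 * (R - W * X) + W * (X + C)
        ring = solve-∀

      p∣ω³-1 : p∣ + ω * + ω * + ω - + 1
      p∣ω³-1 = ∣-lin₁ p∣ω²+ω+1 (+ ω - + 1) (ring (+ ω))
        where
        ring : ∀ W → W * W * W - + 1 ≡ (W - + 1) * (W * W + W + + 1)
        ring = solve-∀

      ρ³ : x < p → ρ (ρ (ρ x)) ≡ x
      ρ³ {x} x<p = residue-injective ρ-< x<p
        (∣-lin₂ (ρ-cong (ρ-cong (ρ-cong (∣-lin₁ ∣-refl (+ 0) (ring₀ (+ x) (+ p)))))) p∣ω³-1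
                (+ 1) (+ x) (ring (+ ρ (ρ (ρ x))) (+ ω) (+ x)))
        where
        ring₀ : ∀ X P → X + - X ≡ + 0 * P
        ring₀ = solve-∀
        ring : ∀ R W X → R - X ≡ + 1 * (R + W * (W * (W * - X))) + X * (W * W * W - + 1)
        ring = solve-∀

      p∤ω-1 : ¬ p∣ + ω - + 1
      p∤ω-1 p∣ω-1 =
        ∤-positive (s≤s z≤n) 3<p (∣-lin₂ p∣ω²+ω+1 p∣ω-1 (+ 1) (- (+ ω + + 2)) (ring (+ ω)))
        where
        ring : ∀ W → + 3 ≡ + 1 * (W * W + W + + 1) + - (W + + 2) * (W - + 1)
        ring = solve-∀
        3<p = n%3≡1⇒3<n 1<p p%3≡1

      ρ-moved : 0 < x → x < p → ρ x ≢ x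
      ρ-moved {x} 0<x x<p ρx≡x
        with ∣*⇒∣⊎∣ (∣-lin₁ (subst (λ r → p∣ + r - + ω * + x) ρx≡x (ρ-spec x))
                            (- + 1) (ring (+ ω) (+ x)))
        where
        ring : ∀ W X → (W - + 1) * X ≡ - + 1 * (X - W * X)
        ring = solve-∀
      ... | inj₁ p∣ω-1 = p∤ω-1 p∣ω-1
      ... | inj₂ p∣x   = ∤-positive 0<x x<p p∣x

      ρ-cube : ∀ x → (ρ x ^ 3 ℕ.+ 1) % p ≡ (x ^ 3 ℕ.+ 1) % p
      ρ-cube x = ∣-⇒%≡ _ _ (subst₂ (λ a b → p∣ a + + 1 - (b + + 1)) (sym (+-^3 (ρ x))) (sym (+-^3 x))
        (∣-lin₂ (ρ-spec x) p∣ω³-1 (R * R + R * W * X + W * W * X * X) (X * X * X) (ring R W X)))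
        where
        R = + ρ x
        W = + ω
        X = + x
        ring : ∀ R W X → R * R * R + + 1 - (X * X * X + + 1)
                         ≡ (R * R + R * W * X + W * W * X * X) * (R - W * X) + X * X * X * (W * W * W - + 1)
        ring = solve-∀

      count-x³+1-mod3 : ∀ (H : ℕ → Bool) →
                        ∃ λ k → count (λ x → H ((x ^ 3 ℕ.+ 1) % p)) p ≡ toℕ (H 1) ℕ.+ 3 ℕ.* k
      count-x³+1-mod3 H = k , (begin
        count P p
          ≡⟨ count-remove P 0<p ⟩
        toℕ (P 0) ℕ.+ count (P ∖∖ [ 0 ]) p
          ≡⟨ cong₂ ℕ._+_ (cong (toℕ ∘ H) (m<n⇒m%n≡m 1<p)) count≡ ⟩
        toℕ (H 1) ℕ.+ (count (OrbitsOfρ.Fix (P ∖∖ [ 0 ])) p ℕ.+ 3 ℕ.* k)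
          ≡⟨ cong (λ c → toℕ (H 1) ℕ.+ (c ℕ.+ 3 ℕ.* k)) (count-none _ p no-fixed-point) ⟩
        toℕ (H 1) ℕ.+ 3 ℕ.* k ∎)
        where
        open ≡-Reasoning
        P : ℕ → Bool
        P x = H ((x ^ 3 ℕ.+ 1) % p)
        P-Order3On : OrbitsOfρ.Order3On P
        P-Order3On = record
          { σ-< = λ _ _ → ρ-<
          ; σ-P = λ {x} _ Px → trans (cong H (ρ-cube x)) Px
          ; σ³  = λ x<p _ → ρ³ x<p
          }
        0-closed : ∀ {z} → z ∈ [ 0 ] → ρ z ∈ [ 0 ]
        0-closed (here refl) = here ρ-0
        no-fixed-point : ∀ {y} → y < p → OrbitsOfρ.Fix (P ∖∖ [ 0 ]) y ≡ false
        no-fixed-point {zero}  _   =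
          trans (cong (does (ρ 0 ≟ 0) ∧_) (∧-zeroʳ (P 0))) (∧-zeroʳ (does (ρ 0 ≟ 0)))
        no-fixed-point {suc y} y<p =
          cong (_∧ (P ∖∖ [ 0 ]) (suc y)) (dec-false (ρ (suc y) ≟ suc y) (ρ-moved (s≤s z≤n) y<p))
        orbits = OrbitsOfρ.count≡countFix+3k (P ∖∖ [ 0 ]) (OrbitsOfρ.∖∖-Order3On P-Order3On 0-closed)
        k = proj₁ orbits
        count≡ = proj₂ orbits

      p∸1<p : p ∸ 1 < p
      p∸1<p = ∸-monoʳ-< {o = 0} (s≤s z≤n) (ℕ.<⇒≤ 1<p)

      +[p∸1] : + (p ∸ 1) ≡ + p - + 1
      +[p∸1] = sym (trans (m-n≡m⊖n p 1) (⊖-≥ (ℕ.<⇒≤ 1<p)))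

      x+1≡0⇒x≡p∸1 : x < p → p∣ + x + + 1 → x ≡ p ∸ 1
      x+1≡0⇒x≡p∸1 {x} x<p p∣x+1 = residue-injective x<p p∸1<p
        (∣-lin₂ p∣x+1 ∣-refl (+ 1) (- + 1) (trans (cong (λ r → + x - r) +[p∸1]) (ring (+ x) (+ p))))
        where
        ring : ∀ X P → X - (P - + 1) ≡ + 1 * (X + + 1) + - + 1 * P
        ring = solve-∀

      ω³-cancel : p∣ + x + + ω * (+ ω * + ω) → p∣ + x + + 1
      ω³-cancel {x} p∣x+ω³ = ∣-lin₂ p∣x+ω³ p∣ω³-1 (+ 1) (- + 1) (ring (+ x) (+ ω))
        where
        ring : ∀ X W → X + + 1 ≡ + 1 * (X + W * (W * W)) + - + 1 * (W * W * W - + 1)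
        ring = solve-∀

      -- ρ multiplies by ω, so these are -1, -ω, -ω² modulo p.
      roots : List ℕ
      roots = OrbitsOfρ.orbit (p ∸ 1)

      root-p∸1 : ((p ∸ 1) ^ 3 ℕ.+ 1) % p ≡ 0
      root-p∸1 = n∣m⇒m%n≡0 _ p (∣⇒∣ᵤ (subst (λ r → p∣ r + + 1) (sym (+-^3 (p ∸ 1)))
        (∣-lin₁ ∣-refl (+ p * + p - + 3 * + p + + 3) (trans (cong (λ r → r * r * r + + 1) +[p∸1]) (ring (+ p))))))
        where
        ring : ∀ P → (P - + 1) * (P - + 1) * (P - + 1) + + 1 ≡ (P * P - + 3 * P + + 3) * P
        ring = solve-∀

      ∈⇒root : x ∈ roots → (x ^ 3 ℕ.+ 1) % p ≡ 0
      ∈⇒root (here refl)                 = root-p∸1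
      ∈⇒root (there (here refl))         = trans (ρ-cube _) root-p∸1
      ∈⇒root (there (there (here refl))) = trans (ρ-cube _) (trans (ρ-cube _) root-p∸1)

      root⇒factors : (x ^ 3 ℕ.+ 1) % p ≡ 0 → p∣ (+ x + + 1) * (+ x + + ω) * (+ x + + ω * + ω)
      root⇒factors {x} root =
        ∣-lin₃ p∣x³+1 p∣ω²+ω+1 p∣ω³-1 (+ 1) (+ x * + x + + x) (+ x + + 1) (ring (+ x) (+ ω))
        where
        p∣x³+1 : p∣ + x * + x * + x + + 1
        p∣x³+1 = subst (λ r → p∣ r + + 1) (+-^3 x) (∣ᵤ⇒∣ (m%n≡0⇒n∣m _ p root))
        ring : ∀ X W → (X + + 1) * (X + W) * (X + W * W)
                       ≡ + 1 * (X * X * X + + 1) + (X * X + X) * (W * W + W + + 1) + (X + + 1) * (W * W * W - + 1)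
        ring = solve-∀

      root⇒∈ : x < p → (x ^ 3 ℕ.+ 1) % p ≡ 0 → x ∈ roots
      root⇒∈ {x} x<p root with ∣*⇒∣⊎∣ (root⇒factors {x} root)
      ... | inj₂ p∣x+ω² = there (there (here (trans (sym (ρ³ x<p)) (cong (ρ ∘ ρ) ρx≡p∸1))))
        where ρx≡p∸1 = x+1≡0⇒x≡p∸1 ρ-< (ω³-cancel (ρ-cong p∣x+ω²))
      ... | inj₁ p∣[x+1][x+ω] with ∣*⇒∣⊎∣ p∣[x+1][x+ω]
      ...   | inj₁ p∣x+1 = here (x+1≡0⇒x≡p∸1 x<p p∣x+1)
      ...   | inj₂ p∣x+ω = there (here (trans (sym (ρ³ x<p)) (cong ρ ρ²x≡p∸1)))
        where ρ²x≡p∸1 = x+1≡0⇒x≡p∸1 ρ-< (ω³-cancel (ρ-cong (ρ-cong p∣x+ω)))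

      isRoot : ℕ → Bool
      isRoot x = does ((x ^ 3 ℕ.+ 1) % p ≟ 0)

      count-roots : count isRoot p ≡ 3
      count-roots = trans
        (count-cong isRoot (λ x → does (x ∈? roots)) p λ {x} x<p →
           does-≡ (root⇒∈ x<p) ∈⇒root ((x ^ 3 ℕ.+ 1) % p ≟ 0) (x ∈? roots))
        (count-∈ (OrbitsOfρ.orbit-unique (ρ-moved (m<n⇒0<n∸m 1<p) p∸1<p) (ρ³ p∸1<p))
                 (p∸1<p ∷ ρ-< ∷ ρ-< ∷ []))

    -- isSquareMod p u unfolds to isSquare (u % p), which makes legendre≡ a computation.
    isSquare : ℕ → Bool
    isSquare r = any (λ y → (y ℕ.* y) % p ≡ᵇ r) (upTo p)

    isQR isQNR : ℕ → Bool
    isQR  r = not (r ≡ᵇ 0) ∧ isSquare r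
    isQNR r = not (r ≡ᵇ 0) ∧ not (isSquare r)

    legendre≡ : ∀ u → legendre p u ≡ + toℕ (isQR (u % p)) - + toℕ (isQNR (u % p))
    legendre≡ u with (u % p) ≡ᵇ 0
    ... | true  = refl
    ... | false with isSquare (u % p)
    ...   | true  = refl
    ...   | false = refl

    isSquare-1 : isSquare 1 ≡ true
    isSquare-1 = Equivalence.to T-≡
      (any⁺ _ (lose (∈-upTo⁺ 1<p) (Equivalence.from T-≡ (cong (_≡ᵇ 1) (m<n⇒m%n≡m 1<p)))))

    -- Opaque: theorem12 needs only the statement, never the construction of ω.
    opaque
      charSum-decomposition : p % 3 ≡ 1 →
        ∃ λ a → ∃ λ b → charSum p ≡ + (1 ℕ.+ 3 ℕ.* a) - + (3 ℕ.* b)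
                      × (1 ℕ.+ 3 ℕ.* a) ℕ.+ 3 ℕ.* b ℕ.+ 3 ≡ p
      charSum-decomposition p%3≡1 with ∃-root-of-x²+x+1 p%3≡1
      ... | ω , _ , p∣ω²+ω+1 = k₁ , k₂ , charSum≡ , p≡
        where
        open Rotation p%3≡1 {ω} p∣ω²+ω+1
        open ≡-Reasoning
        QR QNR : ℕ → Bool
        QR x = isQR ((x ^ 3 ℕ.+ 1) % p)
        QNR x = isQNR ((x ^ 3 ℕ.+ 1) % p)
        k₁ k₂ : ℕ
        k₁ = proj₁ (count-x³+1-mod3 isQR)
        k₂ = proj₁ (count-x³+1-mod3 isQNR)
        count-QR : count QR p ≡ 1 ℕ.+ 3 ℕ.* k₁
        count-QR = trans (proj₂ (count-x³+1-mod3 isQR)) (cong (λ b → toℕ b ℕ.+ 3 ℕ.* k₁) isSquare-1)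
        count-QNR : count QNR p ≡ 3 ℕ.* k₂
        count-QNR = trans (proj₂ (count-x³+1-mod3 isQNR)) (cong (λ b → toℕ (not b) ℕ.+ 3 ℕ.* k₂) isSquare-1)
        charSum≡ : charSum p ≡ + (1 ℕ.+ 3 ℕ.* k₁) - + (3 ℕ.* k₂)
        charSum≡ = begin
          charSum p
            ≡⟨ cong (foldr _+_ (+ 0)) (map-cong (λ x → legendre≡ (x ^ 3 ℕ.+ 1)) (upTo p)) ⟩
          foldr _+_ (+ 0) (map (λ x → + toℕ (QR x) - + toℕ (QNR x)) (upTo p))
            ≡⟨ sum-applyUpTo QR QNR id p ⟩
          + count QR p - + count QNR p
            ≡⟨ cong₂ (λ c₁ c₂ → + c₁ - + c₂) count-QR count-QNR ⟩
          + (1 ℕ.+ 3 ℕ.* k₁) - + (3 ℕ.* k₂) ∎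
        p≡ : (1 ℕ.+ 3 ℕ.* k₁) ℕ.+ 3 ℕ.* k₂ ℕ.+ 3 ≡ p
        p≡ = begin
          (1 ℕ.+ 3 ℕ.* k₁) ℕ.+ 3 ℕ.* k₂ ℕ.+ 3
            ≡⟨ cong₂ (λ c₁ c₂ → c₁ ℕ.+ c₂ ℕ.+ 3) count-QR count-QNR ⟨
          count QR p ℕ.+ count QNR p ℕ.+ 3
            ≡⟨ cong (count QR p ℕ.+ count QNR p ℕ.+_) count-roots ⟨
          count QR p ℕ.+ count QNR p ℕ.+ count isRoot p
            ≡⟨ count-partition QR QNR isRoot p (λ x → trichotomy ((x ^ 3 ℕ.+ 1) % p)) ⟩
          p ∎
          where
          trichotomy : ∀ r → toℕ (isQR r) ℕ.+ toℕ (isQNR r) ℕ.+ toℕ (r ≡ᵇ 0) ≡ 1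
          trichotomy r with r ≡ᵇ 0 | isSquare r
          ... | true  | _     = refl
          ... | false | true  = refl
          ... | false | false = refl

%6≡1⇒%3≡1 : ∀ n → n % 6 ≡ 1 → n % 3 ≡ 1
%6≡1⇒%3≡1 n n%6≡1 = trans (sym (m∣n⇒o%n%m≡o%m 3 6 n (ℕ∣.divides 2 refl))) (cong (_% 3) n%6≡1)

6∣[1+3a]-3b-4 : ∀ {n} a b → n % 6 ≡ 1 → 1 ℕ.+ 3 ℕ.* a ℕ.+ 3 ℕ.* b ℕ.+ 3 ≡ n →
                + 6 Signed.∣ + (1 ℕ.+ 3 ℕ.* a) - + (3 ℕ.* b) - + 4
6∣[1+3a]-3b-4 {n} a b n%6≡1 n≡ = Signed.divides (+ m - + b - + 1) (begin
  + 1 + A - B - + 4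
    ≡⟨ ring₁ A B ⟩
  (+ 1 + A + B + + 3) - + 2 * B - + 7
    ≡⟨ cong (λ t → t - + 2 * B - + 7) (cong +_ (trans n≡ n≡1+6m)) ⟩
  + 1 + + (m ℕ.* 6) - + 2 * B - + 7
    ≡⟨ cong₂ (λ s t → + 1 + s - + 2 * t - + 7) (pos-* m 6) (pos-* 3 b) ⟩
  + 1 + + m * + 6 - + 2 * (+ 3 * + b) - + 7
    ≡⟨ ring₂ (+ m) (+ b) ⟩
  (+ m - + b - + 1) * + 6 ∎)
  where
  open ≡-Reasoning
  m = n ℕ./ 6
  n≡1+6m : n ≡ 1 ℕ.+ m ℕ.* 6
  n≡1+6m = trans (m≡m%n+[m/n]*n n 6) (cong (ℕ._+ m ℕ.* 6) n%6≡1)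
  A = + (3 ℕ.* a)
  B = + (3 ℕ.* b)
  ring₁ : ∀ A B → + 1 + A - B - + 4 ≡ (+ 1 + A + B + + 3) - + 2 * B - + 7
  ring₁ = solve-∀
  ring₂ : ∀ M B → + 1 + M * + 6 - + 2 * (+ 3 * B) - + 7 ≡ (M - B - + 1) * + 6
  ring₂ = solve-∀

theorem12 : (p : ℕ) → .{{_ : NonZero p}} → Prime p → p % 6 ≡ 1 →
    (+ 6) ∣ (charSum p - + 4)
theorem12 p p-prime p%6≡1 with charSum-decomposition p p-prime (%6≡1⇒%3≡1 p p%6≡1)
... | a , b , charSum≡ , p≡ =
  subst (λ s → + 6 ∣ s - + 4) (sym charSum≡) (∣⇒∣ᵤ (6∣[1+3a]-3b-4 a b p%6≡1 p≡))
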